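{- Let $n\ge 3$, consider the ring $X=\{1,\dots,n\}$ with variables $q_{i,i+1},q_{i+1,i}$ and $Q$, $T$, $R$ as in the context. For $i,j\in X$ let $[i,j]\in T$ denote the unique covering tree rooted at $i$ having no edge between $j$ and $j+1$. Let $G$ be the subgraph of the weighted oriented graph on $T$ (edge $s\to t$ present with weight $r_{st}$ whenever $r_{st}\neq0$, $s\ne t$) induced on the vertex set $\{[1,n],[2,1],[3,1],\dots,[n,1],[1,1]\}$, and $H$ the induced subgraph on $\{[1,n],[2,n],[3,n],\dots,[n,n],[1,1]\}$. Then the generating function of covering forests of $G$ rooted at $[1,n]$ and $[1,1]$ equals $\det(-Q^{(1)})$, the generating function of covering trees of $X$ rooted at $1$; and the same holds with $H$ in place of $G$.
   Context: The ring is the oriented graph on $X=\{1,\dots,n\}$ with edges $(i,i\pm1)$, indices modulo $n$; $Q$ has off-diagonal entries $q_{i,i\pm1}$ (zero otherwise) and rows summing to zero. A covering tree rooted at $i$ is an oriented subgraph which is a tree with a unique oriented path from every vertex to $i$; $T$ is the set of all covering rooted trees. Lifted rates: for $s\in T$ rooted at $i$ and $j=i\pm1$, remove from $s$ the edge out of $j$ and add edge $(i,j)$ to get $t$ rooted at $j$, and set $r_{st}=q_{ij}$; other off-diagonal $r_{st}$ are $0$. A covering forest of an oriented graph rooted at a set of vertices $\{a,b\}$ is a set of edges such that every vertex has a unique oriented path to exactly one of $a,b$ and $a,b$ have no outgoing edge; its weight is the product of the edge weights, and the generating function is the sum of weights over all such forests. $Q^{(1)}$ is $Q$ with row and column $1$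 deleted; $\det(-Q^{(1)})$ equals the sum over covering trees rooted at $1$ of the product of $q_{kl}$ over their edges. -}

module Defs where

open import Data.Nat as ℕ using (ℕ; zero; suc; _≤_; s≤s; z≤n)
open import Data.Fin using (Fin; zero; suc; toℕ; fromℕ; fromℕ<; inject₁; punchIn)
open import Data.Fin.Properties using () renaming (_≟_ to _≟ᶠ_)
open import Data.Bool using (Bool; true; false; _∧_; _∨_; if_then_else_)
open import Data.List using (List; []; _∷_; map; foldr; concatMap; allFin)
open import Data.Vec using (Vec; lookup; tabulate) renaming (_∷_ to _∷ᵥ_)
open import Data.Maybe using (Maybe; just; nothing; is-just; fromMaybe)
open import Data.Product using (_×_; _,_; ∃)
open import Data.Sum using (_⊎_)
open import Relation.Nullary using (¬_; yes; no)
open import Relation.Nullary.Decidable using (⌊_⌋)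
open import Relation.Binary.PropositionalEquality using (_≡_)
open import Algebra.Bundles using (CommutativeRing)

-- The ring X = {1,…,n}, encoded as Fin n (paper vertex k ↦ Fin (k-1)).

next : ∀ {n} → Fin n → Fin n
next {suc m} i with suc (toℕ i) ℕ.<? suc m
... | yes p = fromℕ< p
... | no _  = zero

prev : ∀ {n} → Fin n → Fin n
prev {suc m} zero    = fromℕ m
prev {suc m} (suc i) = inject₁ i

_==_ : ∀ {n} → Fin n → Fin n → Bool
i == j = ⌊ i ≟ᶠ j ⌋

all : ∀ {A : Set} → (A → Bool) → List A → Bool
all p = foldr (λ x r → p x ∧ r) true

even : ℕ → Bool
even zero          = true
even (suc zero)    = false
even (suc (suc k)) = even k

iter : ∀ {A : Set} → (A → A) → ℕ → A → A
iter f zero    x = x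
iter f (suc k) x = iter f k (f x)

-- Rooted covering trees of the ring.
-- A rooted tree is given by its root i and its parent map p; its edge set
-- is {(v , p v) | v ≠ i}; by convention p i = i.

record RTree (n : ℕ) : Set where
  constructor rtree
  field
    root   : Fin n
    parent : Fin n → Fin n
open RTree public

IsCoveringTree : ∀ {n} → RTree n → Set
IsCoveringTree (rtree i p) =
  (p i ≡ i)
  × (∀ v → ¬ v ≡ i → (p v ≡ next v ⊎ p v ≡ prev v))
  × (∀ v → ∃ λ k → iter p k v ≡ i)

NoEdgeBetween : ∀ {n} → RTree n → Fin n → Fin n → Set
NoEdgeBetween (rtree i p) a b =
  ∀ v → ¬ v ≡ i → ¬ (v ≡ a × p v ≡ b) × ¬ (v ≡ b × p v ≡ a)

IsBracket : ∀ {n} → RTree n → Fin n → Fin n → Set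
IsBracket t i j = (root t ≡ i) × IsCoveringTree t × NoEdgeBetween t j (next j)

-- Lifted rates: s rooted at i, j = i ± 1; t = s minus the edge out of j
-- plus the edge (i , j), rooted at j.  Then r_st = q_ij.

liftB : ∀ {n} → RTree n → RTree n → Bool
liftB {n} (rtree i s) (rtree j t) =
  (j == next i ∨ j == prev i)
  ∧ all (λ v → t v == (if v == j then j else (if v == i then j else s v)))
        (allFin n)

extend : ∀ {m k} → Fin k → (Fin m → Fin k) → Fin (suc m) → Fin k
extend x f zero    = x
extend x f (suc i) = f i

allFuns : ∀ m k → List (Fin m → Fin k)
allFuns zero    k = (λ ()) ∷ []
allFuns (suc m) k = concatMap (λ f → map (λ x → extend x f) (allFin k)) (allFuns m k)

module _ {c ℓ} (R : CommutativeRing c ℓ) where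
  open CommutativeRing R using (Carrier; _+_; _*_; -_; 0#; 1#)

  sumL : List Carrier → Carrier
  sumL = foldr _+_ 0#

  prodL : List Carrier → Carrier
  prodL = foldr _*_ 1#

  -- The weighted oriented graph on T: edge s → t (s ≠ t) present with
  -- weight r_st whenever s,t are related by lifting; q : X → X → R gives
  -- the rates q_kl (only entries with l = k ± 1 are used).
  liftRate : ∀ {n} → (Fin n → Fin n → Carrier) → RTree n → RTree n → Maybe Carrier
  liftRate q s t = if liftB s t then just (q (root s) (root t)) else nothing

  induced : ∀ {n m} → (Fin n → Fin n → Carrier) → Vec (RTree n) m
          → Fin m → Fin m → Maybe Carrier
  induced q vs u v = if u == v then nothing else liftRate q (lookup vs u) (lookup vs v)

  -- A set of edges in which
  -- a, b have no outgoing edge and every vertex has a unique oriented path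
  -- to exactly one of a, b is the same as: every other vertex v has
  -- exactly one outgoing edge (v , f v), and following f from any vertex
  -- reaches a or b.  We encode a forest by f (with f a = a, f b = b).
  module _ {m : ℕ} (w : Fin m → Fin m → Maybe Carrier) (a b : Fin m) where
    isRoot : Fin m → Bool
    isRoot v = v == a ∨ v == b

    isForest : (Fin m → Fin m) → Bool
    isForest f = all ok (allFin m)
      where
      ok : Fin m → Bool
      ok v = if isRoot v then f v == v
             else (is-just (w v (f v)) ∧ isRoot (iter f m v))

    forestWeight : (Fin m → Fin m) → Carrier
    forestWeight f =
      prodL (map (λ v → if isRoot v then 1# else fromMaybe 0# (w v (f v))) (allFin m))

    forestGF : Carrier
    forestGF = sumL (map (λ f → if isForest f then forestWeight f else 0#) (allFuns m m))

  det : ∀ {m} → (Fin m → Fin m → Carrier) → Carrier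
  det {zero}  M = 1#
  det {suc m} M = sumL (map (λ j → sgn j * (M zero j * det (λ a b → M (suc a) (punchIn j b))))
                            (allFin (suc m)))
    where
    sgn : Fin (suc m) → Carrier
    sgn j = if even (toℕ j) then 1# else - 1#

  Qmat : ∀ {n} → (Fin n → Fin n → Carrier) → Fin n → Fin n → Carrier
  Qmat q i j =
    if i == j then - (q i (next i) + q i (prev i))
    else (if (j == next i ∨ j == prev i) then q i j else 0#)

  negQ1 : ∀ {n} → 3 ≤ n → (Fin n → Fin n → Carrier) → Fin (ℕ.pred n) → Fin (ℕ.pred n) → Carrier
  negQ1 {suc m} _ q a b = - Qmat q (suc a) (suc b)

-- Vertex sets of G and H (the trees [i,j] given by a parent-map family τ,
-- [i,j] = rtree i (τ i j)).  Roots of the forests: [1,n] (index 0) and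
-- [1,1] (index 1).

Gverts : ∀ {n} → 3 ≤ n → (Fin n → Fin n → Fin n → Fin n) → Vec (RTree n) (suc n)
Gverts {suc m} _ τ =
  rtree zero (τ zero (fromℕ m)) ∷ᵥ rtree zero (τ zero zero)
  ∷ᵥ tabulate (λ v → rtree (suc v) (τ (suc v) zero))

Hverts : ∀ {n} → 3 ≤ n → (Fin n → Fin n → Fin n → Fin n) → Vec (RTree n) (suc n)
Hverts {suc m} _ τ =
  rtree zero (τ zero (fromℕ m)) ∷ᵥ rtree zero (τ zero zero)
  ∷ᵥ tabulate (λ v → rtree (suc v) (τ (suc v) (fromℕ m)))

pos[1,n] : ∀ {n} → 3 ≤ n → Fin (suc n)
pos[1,n] _ = zero

pos[1,1] : ∀ {n} → 3 ≤ n → Fin (suc n)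
pos[1,1] {suc m} _ = suc zero

-- Every covering tree of the ring points towards its root along the arc that avoids
-- its missing edge, so each [i,j] is explicit.  Lifting a tree rooted at k to one
-- rooted at k ± 1 only moves the edge out of k ± 1; hence in G and in H a lift exists
-- exactly between consecutive members of [1,n], [2,·], …, [n,·], [1,1], and both
-- graphs are paths with ends [1,n] and [1,1], the step from [k,·] towards [k-1,·]
-- weighing q_{k,k-1} and towards [k+1,·] weighing q_{k,k+1}.  A covering forest of a
-- path rooted at its ends is determined by the split point s ∈ {1,…,n}: the trees
-- [2,·],…,[s,·] step down, the others up.  Its generating function is therefore
-- Σ_s ∏_{2≤k≤s} q_{k,k-1} ∏_{s<k≤n} q_{k,k+1}.  The matrix −Q^(1) is tridiagonal with
-- diagonal q_{k,k+1} + q_{k,k-1}, and expanding along the first row shows that its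
-- determinant obeys the same two-term recursion as this sum.

module Submission where

open import Defs
open import Data.Nat as ℕ using (ℕ; zero; suc; _≤_; _<_; s≤s; z≤n; _∸_; _<ᵇ_)
open import Data.Nat.Properties as ℕₚ using (≤-refl; ≤-trans; <-irrefl; n≤1+n; m≤m+n)
open import Data.Fin using (Fin; zero; suc; toℕ; fromℕ; fromℕ<; inject₁; punchIn)
open import Data.Fin.Properties using (toℕ-fromℕ<; toℕ-fromℕ; toℕ-inject₁; toℕ-injective; toℕ<n; toℕ≤pred[n]; <⇒≢) renaming (_≟_ to _≟ᶠ_)
open import Data.Bool using (Bool; true; false; _∧_; _∨_; not; if_then_else_)
open import Data.Bool.Properties using (∧-identityʳ; ∧-zeroʳ; ∨-zeroʳ)
open import Data.List using (List; []; _∷_; _++_; foldr; map; concatMap; allFin; tabulate)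
open import Data.List.Properties using (map-tabulate; map-cong; map-∘)
open import Data.Vec using (Vec; lookup) renaming (_∷_ to _∷ᵥ_; tabulate to tabulateᵥ)
open import Data.Vec.Properties using (lookup∘tabulate)
import Data.Vec.Functional as Vector
open import Data.Maybe using (Maybe; just; nothing; is-just; fromMaybe)
open import Data.Product using (Σ; _×_; _,_; proj₁; proj₂)
open import Data.Sum using (_⊎_; inj₁; inj₂)
open import Data.Empty using (⊥; ⊥-elim)
open import Function using (id; _∘_)
open import Level using (_⊔_)
open import Relation.Nullary using (yes; no)
open import Relation.Binary using (tri<; tri≈; tri>)
open import Relation.Binary.PropositionalEquality using (_≡_; _≢_; _≗_; refl; sym; trans; cong; cong₂; subst; subst₂)
open import Algebra.Bundles using (CommutativeRing)

==-refl : ∀ {n} (i : Fin n) → (i == i) ≡ true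
==-refl i with i ≟ᶠ i
... | yes _  = refl
... | no i≢i = ⊥-elim (i≢i refl)

≡⇒== : ∀ {n} {i j : Fin n} → i ≡ j → (i == j) ≡ true
≡⇒== {i = i} refl = ==-refl i

≢⇒== : ∀ {n} {i j : Fin n} → i ≢ j → (i == j) ≡ false
≢⇒== {i = i} {j} i≢j with i ≟ᶠ j
... | yes i≡j = ⊥-elim (i≢j i≡j)
... | no _    = refl

==⇒≡ : ∀ {n} {i j : Fin n} → (i == j) ≡ true → i ≡ j
==⇒≡ {i = i} {j} _ with i ≟ᶠ j
==⇒≡ _  | yes i≡j = i≡j
==⇒≡ () | no _

<⇒<ᵇ≡true : ∀ {a b} → a < b → (a <ᵇ b) ≡ true
<⇒<ᵇ≡true {zero}  {suc b} _         = refl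
<⇒<ᵇ≡true {suc a} {suc b} (s≤s a<b) = <⇒<ᵇ≡true a<b

≥⇒<ᵇ≡false : ∀ {a b} → b ≤ a → (a <ᵇ b) ≡ false
≥⇒<ᵇ≡false {a}     {zero}  _         = refl
≥⇒<ᵇ≡false {suc a} {suc b} (s≤s b≤a) = ≥⇒<ᵇ≡false b≤a

∧≡true⇒ : ∀ {a b} → a ∧ b ≡ true → a ≡ true × b ≡ true
∧≡true⇒ {true} {true} _ = refl , refl

toℕ>0⇒≢0 : ∀ {n} {i : Fin (suc n)} → 0 < toℕ i → i ≢ zero
toℕ>0⇒≢0 lt refl = <-irrefl refl lt

module _ {m : ℕ} where

  toℕ-next : (i : Fin (suc m)) → toℕ i < m → toℕ (next i) ≡ suc (toℕ i)
  toℕ-next i i<m with suc (toℕ i) ℕ.<? suc m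
  ... | yes p  = toℕ-fromℕ< p
  ... | no ¬p  = ⊥-elim (¬p (s≤s i<m))

  next-last : (i : Fin (suc m)) → toℕ i ≡ m → next i ≡ zero
  next-last i i≡m with suc (toℕ i) ℕ.<? suc m
  ... | yes (s≤s i<m) = ⊥-elim (<-irrefl i≡m i<m)
  ... | no _          = refl

  suc-toℕ-prev : (i : Fin (suc m)) → i ≢ zero → suc (toℕ (prev i)) ≡ toℕ i
  suc-toℕ-prev zero    i≢0 = ⊥-elim (i≢0 refl)
  suc-toℕ-prev (suc i) _   = cong suc (toℕ-inject₁ i)

  prev-next : (i : Fin (suc m)) → prev (next i) ≡ i
  prev-next i with ℕₚ.m≤n⇒m<n∨m≡n (toℕ≤pred[n] i)
  ... | inj₁ i<m = toℕ-injective (ℕₚ.suc-injective (trans (suc-toℕ-prev (next i) next≢0) (toℕ-next i i<m)))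
    where
    next≢0 : next i ≢ zero
    next≢0 = toℕ>0⇒≢0 (subst (0 <_) (sym (toℕ-next i i<m)) (s≤s z≤n))
  ... | inj₂ i≡m rewrite next-last i i≡m = toℕ-injective (trans (toℕ-fromℕ m) (sym i≡m))

  next-prev : (i : Fin (suc m)) → next (prev i) ≡ i
  next-prev zero    = next-last (fromℕ m) (toℕ-fromℕ m)
  next-prev (suc i) = toℕ-injective (trans (toℕ-next (inject₁ i) (subst (_< m) (sym (toℕ-inject₁ i)) (toℕ<n i)))
                                           (cong suc (toℕ-inject₁ i)))

next≢prev : ∀ {m} (x : Fin (suc m)) → prev (prev x) ≢ x → next x ≢ prev x
next≢prev x prev²x≢x next≡prev = prev²x≢x (trans (cong prev (sym next≡prev)) (prev-next x))

iter-2-cycle : ∀ {A : Set} {f : A → A} {x y} → f x ≡ y → f y ≡ x → ∀ k → iter f k x ≡ x ⊎ iter f k x ≡ y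
iter-2-cycle {f = f} {x} {y} fx≡y fy≡x k = trapped k x (inj₁ refl)
  where
  trapped : ∀ k z → z ≡ x ⊎ z ≡ y → iter f k z ≡ x ⊎ iter f k z ≡ y
  trapped zero    z z∈xy        = z∈xy
  trapped (suc k) z (inj₁ refl) = trapped k (f x) (inj₂ fx≡y)
  trapped (suc k) z (inj₂ refl) = trapped k (f y) (inj₁ fy≡x)

iter-cong : ∀ {A : Set} {f g : A → A} → f ≗ g → ∀ k x → iter f k x ≡ iter g k x
iter-cong f≗g zero    x = refl
iter-cong {f = f} {g} f≗g (suc k) x = trans (cong (iter f k) (f≗g x)) (iter-cong f≗g k (g x))

iter-fixed : ∀ {A : Set} (f : A → A) {x y} a {N} → f x ≡ x → a ≤ N → iter f a y ≡ x → iter f N y ≡ x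
iter-fixed f {x} {y} a {N} fx≡x a≤N reaches =
  trans (cong (λ k → iter f k y) (sym (ℕₚ.m+[n∸m]≡n a≤N)))
        (trans (iter-+ a (N ∸ a) y) (trans (cong (iter f (N ∸ a)) reaches) (stays (N ∸ a))))
  where
  iter-+ : ∀ a b y → iter f (a ℕ.+ b) y ≡ iter f b (iter f a y)
  iter-+ zero    b y = refl
  iter-+ (suc a) b y = iter-+ a b (f y)
  stays : ∀ k → iter f k x ≡ x
  stays zero    = refl
  stays (suc k) = trans (cong (iter f k) fx≡x) (stays k)

-- Covering trees and brackets

module CoveringTree {m : ℕ} {i : Fin (suc m)} {p : Fin (suc m) → Fin (suc m)}
                    (cov : IsCoveringTree (rtree i p)) where

  towards-neighbour : ∀ v → v ≢ i → p v ≡ next v ⊎ p v ≡ prev v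
  towards-neighbour = proj₁ (proj₂ cov)

  no-2-cycle : ∀ x y → p x ≡ y → p y ≡ x → x ≢ i → y ≢ i → ⊥
  no-2-cycle x y px≡y py≡x x≢i y≢i with proj₂ (proj₂ cov) x
  ... | k , reaches with iter-2-cycle px≡y py≡x k
  ... | inj₁ ≡x = x≢i (trans (sym ≡x) reaches)
  ... | inj₂ ≡y = y≢i (trans (sym ≡y) reaches)

  -- Once a vertex points forwards, so does every later vertex up to the root:
  -- a vertex pointing backwards would close a 2-cycle with its predecessor.
  forward-run : ∀ x → p x ≡ next x → ∀ d y → toℕ y ≡ toℕ x ℕ.+ d
              → (∀ z → toℕ x ≤ toℕ z → toℕ z ≤ toℕ y → z ≢ i) → p y ≡ next y
  forward-run x px zero y y≡x _ rewrite toℕ-injective {i = y} {j = x} (trans y≡x (ℕₚ.+-identityʳ _)) = px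
  forward-run x px (suc d) y y≡x+d+1 no-root with towards-neighbour y y≢i
    where
    y≢i : y ≢ i
    y≢i = no-root y (subst (toℕ x ≤_) (sym y≡x+d+1) (m≤m+n (toℕ x) (suc d))) ≤-refl
  ... | inj₁ py = py
  ... | inj₂ py = ⊥-elim (no-2-cycle (prev y) y p[prev-y] py prev-y≢i y≢i)
    where
    y≢i : y ≢ i
    y≢i = no-root y (subst (toℕ x ≤_) (sym y≡x+d+1) (m≤m+n (toℕ x) (suc d))) ≤-refl
    suc-prev-y : suc (toℕ (prev y)) ≡ toℕ y
    suc-prev-y = suc-toℕ-prev y (toℕ>0⇒≢0 (subst (0 <_) (sym (trans y≡x+d+1 (ℕₚ.+-suc (toℕ x) d))) (s≤s z≤n)))
    prev-y≡x+d : toℕ (prev y) ≡ toℕ x ℕ.+ d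
    prev-y≡x+d = ℕₚ.suc-injective (trans suc-prev-y (trans y≡x+d+1 (ℕₚ.+-suc (toℕ x) d)))
    prev-y≤y : toℕ (prev y) ≤ toℕ y
    prev-y≤y = subst (toℕ (prev y) ≤_) suc-prev-y (n≤1+n _)
    prev-y≢i : prev y ≢ i
    prev-y≢i = no-root (prev y) (subst (toℕ x ≤_) (sym prev-y≡x+d) (m≤m+n (toℕ x) d)) prev-y≤y
    p[prev-y] : p (prev y) ≡ y
    p[prev-y] = trans (forward-run x px d (prev y) prev-y≡x+d (λ z x≤z z≤ → no-root z x≤z (≤-trans z≤ prev-y≤y)))
                      (next-prev y)

  backward-run : ∀ x → p x ≡ prev x → ∀ d y → toℕ y ℕ.+ d ≡ toℕ x
               → (∀ z → toℕ y ≤ toℕ z → toℕ z ≤ toℕ x → z ≢ i) → p y ≡ prev y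
  backward-run x px zero y y≡x _ rewrite toℕ-injective {i = y} {j = x} (trans (sym (ℕₚ.+-identityʳ _)) y≡x) = px
  backward-run x px (suc d) y y+d+1≡x no-root with towards-neighbour y y≢i
    where
    y≢i : y ≢ i
    y≢i = no-root y ≤-refl (subst (toℕ y ≤_) y+d+1≡x (m≤m+n (toℕ y) (suc d)))
  ... | inj₂ py = py
  ... | inj₁ py = ⊥-elim (no-2-cycle y (next y) py p[next-y] y≢i next-y≢i)
    where
    y≢i : y ≢ i
    y≢i = no-root y ≤-refl (subst (toℕ y ≤_) y+d+1≡x (m≤m+n (toℕ y) (suc d)))
    y<x : toℕ y < toℕ x
    y<x = subst (toℕ y <_) (trans (sym (ℕₚ.+-suc (toℕ y) d)) y+d+1≡x) (m≤m+n (suc (toℕ y)) d)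
    next-y≡ : toℕ (next y) ≡ suc (toℕ y)
    next-y≡ = toℕ-next y (ℕₚ.<-≤-trans y<x (toℕ≤pred[n] x))
    next-y+d≡x : toℕ (next y) ℕ.+ d ≡ toℕ x
    next-y+d≡x = trans (cong (λ a → a ℕ.+ d) next-y≡) (trans (sym (ℕₚ.+-suc (toℕ y) d)) y+d+1≡x)
    y≤next-y : toℕ y ≤ toℕ (next y)
    y≤next-y = subst (toℕ y ≤_) (sym next-y≡) (n≤1+n _)
    next-y≢i : next y ≢ i
    next-y≢i = no-root (next y) y≤next-y (subst (toℕ (next y) ≤_) next-y+d≡x (m≤m+n (toℕ (next y)) d))
    p[next-y] : p (next y) ≡ y
    p[next-y] = trans (backward-run x px d (next y) next-y+d≡x (λ z y'≤z z≤x → no-root z (≤-trans y≤next-y y'≤z) z≤x))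
                      (prev-next y)

step : ∀ {n} → Bool → Fin n → Fin n
step true  = next
step false = prev

-- Does vertex x point to next x in [k,n], resp. [k,1], where K = toℕ k?
forward-[k,n] : ℕ → ℕ → Bool
forward-[k,n] K x = x <ᵇ K

forward-[k,1] : ℕ → ℕ → Bool
forward-[k,1] K x = (x <ᵇ K) ∧ (0 <ᵇ x)

forward-[k,n]-elsewhere : ∀ K x → x ≢ K → forward-[k,n] (suc K) x ≡ forward-[k,n] K x
forward-[k,n]-elsewhere K x x≢K with ℕₚ.<-cmp x K
... | tri< x<K _ _ = trans (<⇒<ᵇ≡true (ℕₚ.<-trans x<K (ℕₚ.n<1+n K))) (sym (<⇒<ᵇ≡true x<K))
... | tri≈ _ x≡K _ = ⊥-elim (x≢K x≡K)
... | tri> _ _ K<x = trans (≥⇒<ᵇ≡false K<x) (sym (≥⇒<ᵇ≡false (ℕₚ.<⇒≤ K<x)))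

forward-[k,n]-at-root : ∀ K → forward-[k,n] (suc K) K ≡ true
forward-[k,n]-at-root K = <⇒<ᵇ≡true (ℕₚ.n<1+n K)

forward-[k,n]-above : ∀ K → forward-[k,n] K (suc K) ≡ false
forward-[k,n]-above K = ≥⇒<ᵇ≡false (ℕₚ.n≤1+n K)

forward-[k,1]-elsewhere : ∀ K x → x ≢ K → forward-[k,1] (suc K) x ≡ forward-[k,1] K x
forward-[k,1]-elsewhere K x x≢K = cong (_∧ (0 <ᵇ x)) (forward-[k,n]-elsewhere K x x≢K)

forward-[k,1]-at-root : ∀ K → 1 ≤ K → forward-[k,1] (suc K) K ≡ true
forward-[k,1]-at-root (suc K) _ rewrite forward-[k,n]-at-root (suc K) = refl

forward-[k,1]-above : ∀ K → forward-[k,1] K (suc K) ≡ false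
forward-[k,1]-above K rewrite forward-[k,n]-above K = refl

module Brackets {m : ℕ} (m≥1 : 1 ≤ m) where

  last one : Fin (suc m)
  last = fromℕ m
  one  = next zero

  next-last≡zero : next last ≡ zero
  next-last≡zero = next-last last (toℕ-fromℕ m)

  toℕ-one : toℕ one ≡ 1
  toℕ-one = toℕ-next zero m≥1

  one≢zero : one ≢ zero
  one≢zero = toℕ>0⇒≢0 (subst (0 <_) (sym toℕ-one) (s≤s z≤n))

  [k,n]-shape : ∀ k p → IsBracket (rtree k p) k last
              → ∀ v → v ≢ k → p v ≡ step (forward-[k,n] (toℕ k) (toℕ v)) v
  [k,n]-shape k p (_ , cov , no-edge) v v≢k with ℕₚ.<-cmp (toℕ v) (toℕ k)
  ... | tri≈ _ v≡k _ = ⊥-elim (v≢k (toℕ-injective v≡k))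
  ... | tri< v<k _ _ rewrite <⇒<ᵇ≡true v<k =
        forward-run zero p[zero] (toℕ v) v refl (λ z _ z≤v → <⇒≢ (ℕₚ.≤-<-trans z≤v v<k))
    where
    open CoveringTree cov
    zero≢k : zero ≢ k
    zero≢k = <⇒≢ (ℕₚ.≤-<-trans z≤n v<k)
    p[zero] : p zero ≡ next zero
    p[zero] with towards-neighbour zero zero≢k
    ... | inj₁ pz = pz
    ... | inj₂ pz = ⊥-elim (proj₂ (no-edge zero zero≢k) (sym next-last≡zero , pz))
  ... | tri> _ _ k<v rewrite ≥⇒<ᵇ≡false (ℕₚ.<⇒≤ k<v) =
        backward-run last p[last] (m ∸ toℕ v) v (trans (ℕₚ.m+[n∸m]≡n (toℕ≤pred[n] v)) (sym (toℕ-fromℕ m)))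
          (λ z v≤z _ z≡k → <⇒≢ (ℕₚ.<-≤-trans k<v v≤z) (sym z≡k))
    where
    open CoveringTree cov
    last≢k : last ≢ k
    last≢k refl = <-irrefl refl (ℕₚ.<-≤-trans k<v (subst (toℕ v ≤_) (sym (toℕ-fromℕ m)) (toℕ≤pred[n] v)))
    p[last] : p last ≡ prev last
    p[last] with towards-neighbour last last≢k
    ... | inj₂ pl = pl
    ... | inj₁ pl = ⊥-elim (proj₁ (no-edge last last≢k) (refl , pl))

  [1,1]-shape : ∀ p → IsBracket (rtree zero p) zero zero → ∀ v → v ≢ zero → p v ≡ next v
  [1,1]-shape p (_ , cov , no-edge) v v≢0 =
    forward-run one p[one] (toℕ v ∸ 1) v (trans (sym (ℕₚ.m+[n∸m]≡n 1≤v)) (cong (λ a → a ℕ.+ (toℕ v ∸ 1)) (sym toℕ-one)))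
      (λ z one≤z _ → toℕ>0⇒≢0 (subst (_≤ toℕ z) toℕ-one one≤z))
    where
    open CoveringTree cov
    1≤v : 1 ≤ toℕ v
    1≤v = ℕₚ.≤∧≢⇒< z≤n (λ 0≡v → v≢0 (toℕ-injective (sym 0≡v)))
    p[one] : p one ≡ next one
    p[one] with towards-neighbour one one≢zero
    ... | inj₁ po = po
    ... | inj₂ po = ⊥-elim (proj₂ (no-edge one one≢zero) (refl , trans po (prev-next zero)))

  [k,1]-shape : ∀ k p → IsBracket (rtree (suc k) p) (suc k) zero
              → ∀ v → v ≢ suc k → p v ≡ step (forward-[k,1] (toℕ {suc m} (suc k)) (toℕ v)) v
  [k,1]-shape k p (_ , cov , no-edge) = shape
    where
    open CoveringTree cov
    zero≢k : zero ≢ suc k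
    zero≢k ()
    p[zero] : p zero ≡ prev zero
    p[zero] with towards-neighbour zero zero≢k
    ... | inj₂ pz = pz
    ... | inj₁ pz = ⊥-elim (proj₁ (no-edge zero zero≢k) (refl , pz))
    shape : ∀ v → v ≢ suc k → p v ≡ step (forward-[k,1] (toℕ {suc m} (suc k)) (toℕ v)) v
    shape zero     _   = p[zero]
    shape (suc v) v≢k with ℕₚ.<-cmp (toℕ {suc m} (suc v)) (toℕ {suc m} (suc k))
    ... | tri≈ _ v≡k _ = ⊥-elim (v≢k (toℕ-injective v≡k))
    ... | tri< v<k _ _ rewrite <⇒<ᵇ≡true v<k =
          forward-run one p[one] (toℕ v) (suc v) (cong (λ a → a ℕ.+ toℕ v) (sym toℕ-one)) (λ z _ z≤v → <⇒≢ (ℕₚ.≤-<-trans z≤v v<k))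
      where
      one<k : toℕ one < toℕ {suc m} (suc k)
      one<k = subst (_< suc (toℕ k)) (sym toℕ-one) (ℕₚ.≤-<-trans (s≤s z≤n) v<k)
      p[one] : p one ≡ next one
      p[one] with towards-neighbour one (<⇒≢ one<k)
      ... | inj₁ po = po
      ... | inj₂ po = ⊥-elim (proj₂ (no-edge one (<⇒≢ one<k)) (refl , trans po (prev-next zero)))
    ... | tri> _ _ k<v rewrite ≥⇒<ᵇ≡false (ℕₚ.<⇒≤ k<v) =
          backward-run last p[last] (m ∸ toℕ (suc v)) (suc v) (trans (ℕₚ.m+[n∸m]≡n (toℕ≤pred[n] (suc v))) (sym (toℕ-fromℕ m)))
            (λ z v≤z _ z≡k → <⇒≢ (ℕₚ.<-≤-trans k<v v≤z) (sym z≡k))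
      where
      last≢k : last ≢ suc k
      last≢k e = <-irrefl refl (ℕₚ.<-≤-trans k<v (subst (toℕ (suc v) ≤_) (sym (trans (cong toℕ (sym e)) (toℕ-fromℕ m))) (toℕ≤pred[n] (suc v))))
      p[last] : p last ≡ prev last
      p[last] with towards-neighbour last last≢k
      ... | inj₂ pl = pl
      ... | inj₁ pl = ⊥-elim (no-2-cycle zero last p[zero] (trans pl next-last≡zero) zero≢k last≢k)

-- Lifting between brackets

all-tabulate : ∀ {A : Set} {k} (p : A → Bool) (g : Fin k → A) → all p (tabulate g) ≡ all (p ∘ g) (allFin k)
all-tabulate {k = zero}  p g = refl
all-tabulate {k = suc k} p g =
  cong (p (g zero) ∧_) (trans (all-tabulate p (g ∘ suc)) (sym (all-tabulate (p ∘ g) suc)))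

all-allFin⁺ : ∀ {k} (p : Fin k → Bool) → (∀ x → p x ≡ true) → all p (allFin k) ≡ true
all-allFin⁺ {zero}  p all-p = refl
all-allFin⁺ {suc k} p all-p rewrite all-p zero | all-tabulate p suc = all-allFin⁺ (p ∘ suc) (all-p ∘ suc)

all-allFin⁻ : ∀ {k} (p : Fin k → Bool) → all p (allFin k) ≡ true → ∀ x → p x ≡ true
all-allFin⁻ {suc k} p all-p x with p zero in p0 | all-p
all-allFin⁻ {suc k} p all-p zero    | true | _    = p0
all-allFin⁻ {suc k} p all-p (suc x) | true | rest = all-allFin⁻ (p ∘ suc) (trans (sym (all-tabulate p suc)) rest) x

all-allFin-false : ∀ {k} (p : Fin k → Bool) x → p x ≡ false → all p (allFin k) ≡ false
all-allFin-false {suc k} p zero    px rewrite px = refl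
all-allFin-false {suc k} p (suc x) px rewrite all-tabulate p suc | all-allFin-false (p ∘ suc) x px = ∧-zeroʳ (p zero)

-- The parent map that liftB demands of t for s to lift to t.
lifted : ∀ {n} → RTree n → RTree n → Fin n → Fin n
lifted s t x = if x == root t then root t else (if x == root s then root t else parent s x)

liftB-intro : ∀ {n} (s t : RTree n) → root t ≡ next (root s) ⊎ root t ≡ prev (root s)
            → (∀ x → parent t x ≡ lifted s t x) → liftB s t ≡ true
liftB-intro (rtree i _) (rtree j _) adjacent agrees =
  cong₂ _∧_ (adjacent-test adjacent) (all-allFin⁺ _ (λ x → ≡⇒== (agrees x)))
  where
  adjacent-test : j ≡ next i ⊎ j ≡ prev i → (j == next i ∨ j == prev i) ≡ true
  adjacent-test (inj₁ refl) rewrite ==-refl (next i) = refl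
  adjacent-test (inj₂ refl) rewrite ==-refl (prev i) = ∨-zeroʳ _

liftB-non-adjacent : ∀ {n} (s t : RTree n) → root t ≢ next (root s) → root t ≢ prev (root s) → liftB s t ≡ false
liftB-non-adjacent (rtree i _) (rtree j _) j≢next j≢prev rewrite ≢⇒== j≢next | ≢⇒== j≢prev = refl

liftB-mismatch : ∀ {n} (s t : RTree n) x → parent t x ≢ lifted s t x → liftB s t ≡ false
liftB-mismatch (rtree i _) (rtree j _) x differs =
  trans (cong ((j == next i ∨ j == prev i) ∧_) (all-allFin-false _ x (≢⇒== differs))) (∧-zeroʳ _)

lifted-elsewhere : ∀ {n} (s t : RTree n) x → x ≢ root t → x ≢ root s → lifted s t x ≡ parent s x
lifted-elsewhere s t x x≢t x≢s rewrite ≢⇒== x≢t | ≢⇒== x≢s = refl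

-- Index 0 stands for [1,n], index 1 for [1,1] and index 2+v for a tree rooted at
-- suc v; the path [1,n] — [2,·] — … — [n,·] — [1,1] visits them in order of position,
-- and the neighbours of inner v on it are leftOf v and rightOf v.
position : ∀ {m} → Fin (suc (suc m)) → ℕ
position         zero          = 0
position {m}     (suc zero)    = suc m
position         (suc (suc v)) = suc (toℕ v)

rootAt : ∀ {m} → Fin (suc (suc m)) → Fin (suc m)
rootAt zero          = zero
rootAt (suc zero)    = zero
rootAt (suc (suc v)) = suc v

inner : ∀ {m} → Fin m → Fin (suc (suc m))
inner v = suc (suc v)

position-injective : ∀ {m} {t t′ : Fin (suc (suc m))} → position t ≡ position t′ → t ≡ t′
position-injective {t = zero}          {zero}           _  = refl
position-injective {t = suc zero}      {suc zero}       _  = refl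
position-injective {t = suc (suc v)}   {suc (suc v′)}   eq = cong inner (toℕ-injective (ℕₚ.suc-injective eq))
position-injective {t = suc zero}      {suc (suc v′)}   eq = ⊥-elim (<-irrefl (sym (ℕₚ.suc-injective eq)) (toℕ<n v′))
position-injective {t = suc (suc v)}   {suc zero}       eq = ⊥-elim (<-irrefl (ℕₚ.suc-injective eq) (toℕ<n v))
position-injective {t = zero}          {suc zero}       ()
position-injective {t = zero}          {suc (suc _)}    ()
position-injective {t = suc zero}      {zero}           ()
position-injective {t = suc (suc _)}   {zero}           ()

module _ {m : ℕ} where

  leftOf : Fin m → Fin (suc (suc m))
  leftOf zero    = zero
  leftOf (suc v) = inner (inject₁ v)

  rightOf : Fin m → Fin (suc (suc m))
  rightOf v with suc (toℕ v) ℕ.<? m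
  ... | yes v+1<m = inner (fromℕ< v+1<m)
  ... | no _      = suc zero

  position-leftOf : ∀ v → position (leftOf v) ≡ toℕ v
  position-leftOf zero    = refl
  position-leftOf (suc v) = cong suc (toℕ-inject₁ v)

  position-rightOf : ∀ v → position (rightOf v) ≡ suc (suc (toℕ v))
  position-rightOf v with suc (toℕ v) ℕ.<? m
  ... | yes v+1<m = cong suc (toℕ-fromℕ< v+1<m)
  ... | no v+1≮m  = cong suc (ℕₚ.≤-antisym (ℕₚ.≮⇒≥ v+1≮m) (toℕ<n v))

  rightOf-last : ∀ v → suc (toℕ v) ≡ m → rightOf v ≡ suc zero
  rightOf-last v v+1≡m with suc (toℕ v) ℕ.<? m
  ... | yes v+1<m = ⊥-elim (<-irrefl v+1≡m v+1<m)
  ... | no _      = refl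

  rightOf-inner : ∀ v → (v+1<m : suc (toℕ v) < m) → rightOf v ≡ inner (fromℕ< v+1<m)
  rightOf-inner v v+1<m with suc (toℕ v) ℕ.<? m
  ... | yes v+1<m′ = cong inner (toℕ-injective (trans (toℕ-fromℕ< v+1<m′) (sym (toℕ-fromℕ< v+1<m))))
  ... | no v+1≮m   = ⊥-elim (v+1≮m v+1<m)

  leftOf≢rightOf : ∀ v → leftOf v ≢ rightOf v
  leftOf≢rightOf v e = <-irrefl (trans (sym (position-leftOf v)) (trans (cong position e) (position-rightOf v)))
                                (ℕₚ.<-trans (ℕₚ.n<1+n _) (ℕₚ.n<1+n _))

  rootAt-leftOf : ∀ v → rootAt (leftOf v) ≡ prev (suc v)
  rootAt-leftOf zero    = refl
  rootAt-leftOf (suc v) = refl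

  rootAt-rightOf : ∀ v → rootAt (rightOf v) ≡ next (suc v)
  rootAt-rightOf v with suc (toℕ v) ℕ.<? m
  ... | yes v+1<m = toℕ-injective (trans (cong suc (toℕ-fromℕ< v+1<m)) (sym (toℕ-next (suc v) v+1<m)))
  ... | no v+1≮m  = sym (next-last (suc v) (ℕₚ.≤-antisym (toℕ<n v) (ℕₚ.≮⇒≥ v+1≮m)))

record IsPathGraph {a} {A : Set a} {m : ℕ} (w : Fin (suc (suc m)) → Fin (suc (suc m)) → Maybe A)
                   (left right : Fin m → A) : Set a where
  field
    to-left  : ∀ v → w (inner v) (leftOf v) ≡ just (left v)
    to-right : ∀ v → w (inner v) (rightOf v) ≡ just (right v)
    no-other : ∀ v t → t ≢ leftOf v → t ≢ rightOf v → w (inner v) t ≡ nothing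

leftRate rightRate : ∀ {a} {A : Set a} {m} → (Fin (suc m) → Fin (suc m) → A) → Fin m → A
leftRate  q v = q (suc v) (prev (suc v))
rightRate q v = q (suc v) (next (suc v))

-- D K x tells whether x points to next x in the tree at position K.  Consecutive
-- trees differ only at the vertices K and K+1; the last two hypotheses separate the
-- pairs [n,·], [1,n] and [2,·], [1,1], whose roots are adjacent on the ring but not
-- on the path (they disagree at paper vertex 2, resp. 3).
module Lifting {m : ℕ} (m≥2 : 2 ≤ m) (D : ℕ → ℕ → Bool)
  (D-elsewhere : ∀ K x → x ≢ K → D (suc K) x ≡ D K x)
  (D-at-root   : ∀ K → 1 ≤ K → D (suc K) K ≡ true)
  (D-above     : ∀ K → D K (suc K) ≡ false)
  (D-[1,1]     : D (suc m) 2 ≡ true)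
  (D-[n,·]     : D m 1 ≡ true)
  (vs : Vec (RTree (suc m)) (suc (suc m)))
  (root-vs  : ∀ u → root (lookup vs u) ≡ rootAt u)
  (fixed-vs : ∀ u → parent (lookup vs u) (rootAt u) ≡ rootAt u)
  (shape-vs : ∀ u x → x ≢ rootAt u → parent (lookup vs u) x ≡ step (D (position u) (toℕ x)) x)
  where

  private
    T : Fin (suc (suc m)) → RTree (suc m)
    T = lookup vs

  open Brackets (≤-trans (s≤s z≤n) m≥2) using (one; toℕ-one; one≢zero)

  two : Fin (suc m)
  two = next one

  toℕ-two : toℕ two ≡ 2
  toℕ-two = trans (toℕ-next one (subst (_< m) (sym toℕ-one) m≥2)) (cong suc toℕ-one)

  shape-at : ∀ u x {b} → x ≢ rootAt u → D (position u) (toℕ x) ≡ b → parent (T u) x ≡ step b x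
  shape-at u x x≢root D≡b = trans (shape-vs u x x≢root) (cong (λ b → step b x) D≡b)

  same-direction : ∀ u u′ x → x ≢ rootAt u → x ≢ rootAt u′
                 → D (position u) (toℕ x) ≡ D (position u′) (toℕ x) → parent (T u) x ≡ parent (T u′) x
  same-direction u u′ x x≢u x≢u′ same = trans (shape-at u x x≢u same) (sym (shape-vs u′ x x≢u′))

  lifts-to-left : ∀ v → liftB (T (inner v)) (T (leftOf v)) ≡ true
  lifts-to-left v = liftB-intro (T (inner v)) (T t)
    (inj₂ (trans (root-vs t) (trans (rootAt-leftOf v) (cong prev (sym (root-vs (inner v))))))) agrees
    where
    t = leftOf v
    position-t : ∀ {K} → D (position t) K ≡ D (toℕ v) K
    position-t {K} = cong (λ P → D P K) (position-leftOf v)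
    agrees : ∀ x → parent (T t) x ≡ lifted (T (inner v)) (T t) x
    agrees x rewrite root-vs t | root-vs (inner v) with x ≟ᶠ rootAt t
    ... | yes refl = fixed-vs t
    ... | no x≢t with x ≟ᶠ suc v
    ...   | yes refl = trans (shape-at t (suc v) x≢t (trans position-t (D-above (toℕ v)))) (sym (rootAt-leftOf v))
    ...   | no x≢v = same-direction t (inner v) x x≢t x≢v
                       (trans position-t (sym (D-elsewhere (toℕ v) (toℕ x) x≢t′)))
      where
      x≢t′ : toℕ x ≢ toℕ v
      x≢t′ e = x≢t (toℕ-injective (trans e (sym (trans (cong toℕ (rootAt-leftOf v)) (toℕ-inject₁ v)))))

  lifts-to-right : ∀ v → liftB (T (inner v)) (T (rightOf v)) ≡ true
  lifts-to-right v = liftB-intro (T (inner v)) (T t)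
    (inj₁ (trans (root-vs t) (trans (rootAt-rightOf v) (cong next (sym (root-vs (inner v))))))) agrees
    where
    t = rightOf v
    position-t : ∀ {K} → D (position t) K ≡ D (suc (suc (toℕ v))) K
    position-t {K} = cong (λ P → D P K) (position-rightOf v)
    agrees : ∀ x → parent (T t) x ≡ lifted (T (inner v)) (T t) x
    agrees x rewrite root-vs t | root-vs (inner v) with x ≟ᶠ rootAt t
    ... | yes refl = fixed-vs t
    ... | no x≢t with x ≟ᶠ suc v
    ...   | yes refl = trans (shape-at t (suc v) x≢t (trans position-t (D-at-root (suc (toℕ v)) (s≤s z≤n))))
                             (sym (rootAt-rightOf v))
    ...   | no x≢v = same-direction t (inner v) x x≢t x≢v
                       (trans position-t (D-elsewhere (suc (toℕ v)) (toℕ x) (λ e → x≢v (toℕ-injective e))))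

  non-adjacent : ∀ v t → rootAt t ≢ next (suc v) → rootAt t ≢ prev (suc v) → liftB (T (inner v)) (T t) ≡ false
  non-adjacent v t ≢next ≢prev = liftB-non-adjacent (T (inner v)) (T t)
    (λ e → ≢next (subst₂ (λ a b → a ≡ next b) (root-vs t) (root-vs (inner v)) e))
    (λ e → ≢prev (subst₂ (λ a b → a ≡ prev b) (root-vs t) (root-vs (inner v)) e))

  next-inner≢zero : ∀ (v : Fin m) → suc (toℕ v) ≢ m → next {suc m} (suc v) ≢ zero
  next-inner≢zero v v+1≢m e with trans (sym (toℕ-next (suc v) (ℕₚ.≤∧≢⇒< (toℕ<n v) v+1≢m))) (cong toℕ e)
  ... | ()

  no-lift-elsewhere : ∀ v t → position t ≢ toℕ v → position t ≢ suc (suc (toℕ v))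
                    → liftB (T (inner v)) (T t) ≡ false
  no-lift-elsewhere v zero ≢v _ with suc (toℕ v) ℕ.≟ m
  ... | no v+1≢m = non-adjacent v zero (λ e → next-inner≢zero v v+1≢m (sym e))
                     (λ e → ≢v (trans (cong toℕ e) (toℕ-inject₁ v)))
  ... | yes v+1≡m = liftB-mismatch (T (inner v)) (T zero) one mismatch
    where
    one≢v : one ≢ suc v
    one≢v e = <-irrefl (trans (sym toℕ-one) (trans (cong toℕ e) v+1≡m)) m≥2
    prev²one≢one : prev (prev one) ≢ one
    prev²one≢one e = <-irrefl (trans (sym toℕ-one) (trans (cong toℕ (sym e)) (trans (cong (toℕ ∘ prev) (prev-next zero)) (toℕ-fromℕ m)))) m≥2
    mismatch : parent (T zero) one ≢ lifted (T (inner v)) (T zero) one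
    mismatch e = next≢prev one prev²one≢one
      (sym (trans (sym (shape-at zero one one≢zero (trans (cong (D 0) toℕ-one) (D-above 0))))
        (trans e (trans (lifted-elsewhere (T (inner v)) (T zero) one
                          (λ q → one≢zero (trans q (root-vs zero))) (λ q → one≢v (trans q (root-vs (inner v)))))
                        (shape-at (inner v) one one≢v (trans (cong₂ D v+1≡m toℕ-one) D-[n,·]))))))
  no-lift-elsewhere zero (suc zero) _ _ = liftB-mismatch (T (inner zero)) (T (suc zero)) two mismatch
    where
    two≢0 : two ≢ zero
    two≢0 e with trans (sym toℕ-two) (cong toℕ e)
    ... | ()
    two≢1 : two ≢ suc zero
    two≢1 e with trans (sym toℕ-two) (cong toℕ e)
    ... | ()
    mismatch : parent (T (suc zero)) two ≢ lifted (T (inner zero)) (T (suc zero)) two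
    mismatch e = next≢prev two (λ q → two≢0 (trans (sym q) (trans (cong prev (prev-next one)) (prev-next zero))))
      (trans (sym (shape-at (suc zero) two two≢0 (trans (cong (D (suc m)) toℕ-two) D-[1,1])))
        (trans e (trans (lifted-elsewhere (T (inner zero)) (T (suc zero)) two
                          (λ q → two≢0 (trans q (root-vs (suc zero)))) (λ q → two≢1 (trans q (root-vs (inner zero)))))
                        (shape-at (inner zero) two two≢1 (trans (cong (D 1) toℕ-two) (D-above 1))))))
  no-lift-elsewhere (suc v) (suc zero) _ ≢v+2 =
    non-adjacent (suc v) (suc zero) (λ e → next-inner≢zero (suc v) (λ q → ≢v+2 (cong suc (sym q))) (sym e)) (λ ())
  no-lift-elsewhere v (suc (suc v′)) ≢v ≢v+2 =
    non-adjacent v (inner v′) ≢next (λ e → ≢v (trans (cong toℕ e) (toℕ-inject₁ v)))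
    where
    ≢next : suc v′ ≢ next (suc v)
    ≢next e with suc (toℕ v) ℕ.≟ m
    ... | no v+1≢m  = ≢v+2 (trans (cong toℕ e) (toℕ-next (suc v) (ℕₚ.≤∧≢⇒< (toℕ<n v) v+1≢m)))
    ... | yes v+1≡m with trans e (next-last (suc v) v+1≡m)
    ...   | ()

  module _ {c ℓ} (R : CommutativeRing c ℓ) (q : Fin (suc m) → Fin (suc m) → CommutativeRing.Carrier R) where

    induced-isPathGraph : IsPathGraph (induced R q vs) (leftRate q) (rightRate q)
    induced-isPathGraph = record { to-left = to-left ; to-right = to-right ; no-other = no-other }
      where
      to-left : ∀ v → induced R q vs (inner v) (leftOf v) ≡ just (leftRate q v)
      to-left v with inner v ≟ᶠ leftOf v
      ... | yes e = ⊥-elim (<-irrefl (sym (trans (cong position e) (position-leftOf v))) (ℕₚ.n<1+n (toℕ v)))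
      ... | no _ rewrite lifts-to-left v | root-vs (inner v) | root-vs (leftOf v) | rootAt-leftOf v = refl
      to-right : ∀ v → induced R q vs (inner v) (rightOf v) ≡ just (rightRate q v)
      to-right v with inner v ≟ᶠ rightOf v
      ... | yes e = ⊥-elim (<-irrefl (trans (cong position e) (position-rightOf v)) (ℕₚ.n<1+n (suc (toℕ v))))
      ... | no _ rewrite lifts-to-right v | root-vs (inner v) | root-vs (rightOf v) | rootAt-rightOf v = refl
      no-other : ∀ v t → t ≢ leftOf v → t ≢ rightOf v → induced R q vs (inner v) t ≡ nothing
      no-other v t t≢l t≢r with inner v ≟ᶠ t
      ... | yes _   = refl
      ... | no _ rewrite no-lift-elsewhere v t
                           (λ e → t≢l (position-injective (trans e (sym (position-leftOf v)))))
                           (λ e → t≢r (position-injective (trans e (sym (position-rightOf v))))) = refl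

-- Covering forests of a path

sameFun : ∀ {M K} → (Fin M → Fin K) → (Fin M → Fin K) → Bool
sameFun {M} f g = all (λ v → f v == g v) (allFin M)

sameFun⇒≗ : ∀ {M K} {f g : Fin M → Fin K} → sameFun f g ≡ true → f ≗ g
sameFun⇒≗ same v = ==⇒≡ (all-allFin⁻ _ same v)

≗⇒sameFun : ∀ {M K} {f g : Fin M → Fin K} → f ≗ g → sameFun f g ≡ true
≗⇒sameFun f≗g = all-allFin⁺ _ (λ v → ≡⇒== (f≗g v))

sameFun-extend : ∀ {M K} (x : Fin K) (f : Fin M → Fin K) g
               → sameFun (extend x f) g ≡ (x == g zero) ∧ sameFun f (g ∘ suc)
sameFun-extend x f g = cong ((x == g zero) ∧_) (all-tabulate (λ v → extend x f v == g v) suc)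

threshold : ∀ {k} (P : Fin k → Bool) → (∀ v v′ → toℕ v′ ≡ suc (toℕ v) → P v ≡ true → P v′ ≡ true)
          → Σ (Fin (suc k)) (λ s → ∀ v → P v ≡ not (toℕ v <ᵇ toℕ s))
threshold {zero}  P up = zero , λ ()
threshold {suc k} P up with P zero in P0
... | true = zero , λ v → all-true (toℕ v) v refl
  where
  all-true : ∀ n (v : Fin (suc k)) → toℕ v ≡ n → P v ≡ true
  all-true zero    zero    _ = P0
  all-true (suc n) (suc v) e = up (inject₁ v) (suc v) (cong suc (sym (toℕ-inject₁ v)))
                                  (all-true n (inject₁ v) (trans (toℕ-inject₁ v) (ℕₚ.suc-injective e)))
... | false with threshold (P ∘ suc) (λ v v′ e → up (suc v) (suc v′) (cong suc e))
...   | s , P≡ = suc s , λ { zero → P0 ; (suc v) → P≡ v }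

foldr-map-allFin : ∀ {a b} {A : Set a} {B : Set b} (f : A → B → B) e {k} (g : Fin k → A)
                 → foldr f e (map g (allFin k)) ≡ Vector.foldr f e g
foldr-map-allFin f e {k} g = trans (cong (foldr f e) (map-tabulate id g)) (foldr-tabulate g)
  where
  foldr-tabulate : ∀ {k} (g : Fin k → _) → foldr f e (tabulate g) ≡ Vector.foldr f e g
  foldr-tabulate {zero}  g = refl
  foldr-tabulate {suc k} g = cong (f (g zero)) (foldr-tabulate (g ∘ suc))

module Sums {c ℓ} (R : CommutativeRing c ℓ) where

  open CommutativeRing R hiding (zero)
    renaming (refl to ≈-refl; sym to ≈-sym; trans to ≈-trans; reflexive to ≈-reflexive)
  open import Algebra.Properties.Semiring.Sum semiring public
    using (sum; sum-cong-≋; sum-cong-≗; sum-replicate-zero; ∑-distrib-+; *-distribˡ-sum)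
  open import Algebra.Properties.Monoid.Sum *-monoid public
    using () renaming (sum to product; sum-cong-≗ to product-cong-≗)
  open import Relation.Binary.Reasoning.Setoid setoid

  sum-map-allFin : ∀ {k} (g : Fin k → Carrier) → sumL R (map g (allFin k)) ≡ sum g
  sum-map-allFin = foldr-map-allFin _+_ 0#

  product-map-allFin : ∀ {k} (g : Fin k → Carrier) → prodL R (map g (allFin k)) ≡ product g
  product-map-allFin = foldr-map-allFin _*_ 1#

  sum-zero : ∀ {k} (g : Fin k → Carrier) → (∀ i → g i ≈ 0#) → sum g ≈ 0#
  sum-zero {k} g g≈0 = ≈-trans (sum-cong-≋ g≈0) (sum-replicate-zero k)

  sum-δ : ∀ {k} (y : Fin k) (x : Carrier) → sum (λ i → if i == y then x else 0#) ≈ x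
  sum-δ {suc k} zero    x = ≈-trans (+-congˡ (sum-zero {k} _ (λ _ → ≈-refl))) (+-identityʳ x)
  sum-δ {suc k} (suc y) x = ≈-trans (+-identityˡ _) (≈-trans (sum-cong-≋ {k} same) (sum-δ y x))
    where
    same : ∀ i → (if suc i == suc y then x else 0#) ≈ (if i == y then x else 0#)
    same i with i ≟ᶠ y
    ... | yes _ = ≈-refl
    ... | no _  = ≈-refl

  sumOver : ∀ {A : Set} → (A → Carrier) → List A → Carrier
  sumOver F xs = sumL R (map F xs)

  sumOver-cong : ∀ {A : Set} {F G : A → Carrier} → (∀ x → F x ≈ G x) → ∀ xs → sumOver F xs ≈ sumOver G xs
  sumOver-cong F≈G []       = ≈-refl
  sumOver-cong F≈G (x ∷ xs) = +-cong (F≈G x) (sumOver-cong F≈G xs)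

  sumOver-concatMap : ∀ {A B : Set} (F : B → Carrier) (h : A → List B) xs
                    → sumOver F (concatMap h xs) ≈ sumOver (sumOver F ∘ h) xs
  sumOver-concatMap F h []       = ≈-refl
  sumOver-concatMap F h (x ∷ xs) = ≈-trans (sumOver-++ (h x) _) (+-congˡ (sumOver-concatMap F h xs))
    where
    sumOver-++ : ∀ ys zs → sumOver F (ys ++ zs) ≈ sumOver F ys + sumOver F zs
    sumOver-++ []       zs = ≈-sym (+-identityˡ _)
    sumOver-++ (y ∷ ys) zs = ≈-trans (+-congˡ (sumOver-++ ys zs)) (≈-sym (+-assoc _ _ _))

  sumOver-sum : ∀ {A : Set} {k} (F : A → Fin k → Carrier) xs
              → sumOver (λ x → sum (F x)) xs ≈ sum (λ i → sumOver (λ x → F x i) xs)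
  sumOver-sum {k = k} F [] = ≈-sym (sum-zero {k} _ (λ _ → ≈-refl))
  sumOver-sum F (x ∷ xs) = ≈-trans (+-congˡ (sumOver-sum F xs)) (≈-sym (∑-distrib-+ (F x) _))

  -- allFuns M K lists every function Fin M → Fin K exactly once.
  sumOver-allFuns-δ : ∀ M K (g : Fin M → Fin K) (x : Carrier)
                    → sumOver (λ f → if sameFun f g then x else 0#) (allFuns M K) ≈ x
  sumOver-allFuns-δ zero    K g x = +-identityʳ x
  sumOver-allFuns-δ (suc M) K g x = begin
      sumOver δg (allFuns (suc M) K)
    ≈⟨ sumOver-concatMap δg (λ f → map (λ y → extend y f) (allFin K)) (allFuns M K) ⟩
      sumOver (λ f → sumOver δg (map (λ y → extend y f) (allFin K))) (allFuns M K)
    ≈⟨ sumOver-cong by-head (allFuns M K) ⟩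
      sumOver (λ f → if sameFun f (g ∘ suc) then x else 0#) (allFuns M K)
    ≈⟨ sumOver-allFuns-δ M K (g ∘ suc) x ⟩
      x ∎
    where
    δg : (Fin (suc M) → Fin K) → Carrier
    δg f = if sameFun f g then x else 0#
    by-head : ∀ f → sumOver δg (map (λ y → extend y f) (allFin K)) ≈ (if sameFun f (g ∘ suc) then x else 0#)
    by-head f = begin
        sumOver δg (map (λ y → extend y f) (allFin K))
      ≡⟨ cong (sumL R) (sym (map-∘ (allFin K))) ⟩
        sumL R (map (λ y → δg (extend y f)) (allFin K))
      ≡⟨ sum-map-allFin {K} _ ⟩
        sum (λ y → δg (extend y f))
      ≡⟨ sum-cong-≗ (λ y → cong (λ b → if b then x else 0#) (sameFun-extend y f g)) ⟩
        sum (λ y → if (y == g zero) ∧ sameFun f (g ∘ suc) then x else 0#)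
      ≈⟨ on-tail (sameFun f (g ∘ suc)) ⟩
        (if sameFun f (g ∘ suc) then x else 0#) ∎
      where
      on-tail : ∀ b → sum (λ y → if (y == g zero) ∧ b then x else 0#) ≈ (if b then x else 0#)
      on-tail true  = ≈-trans (≈-reflexive (sum-cong-≗ {K} (λ y → cong (λ b → if b then x else 0#) (∧-identityʳ (y == g zero)))))
                              (sum-δ (g zero) x)
      on-tail false = sum-zero {K} _ (λ y → ≈-reflexive (cong (λ b → if b then x else 0#) (∧-zeroʳ (y == g zero))))

  -- splitSum left right = Σ_{s ≤ k} left 0 ⋯ left (s-1) · right s ⋯ right (k-1), by sum-splitProduct.
  splitSum : ∀ {k} → (Fin k → Carrier) → (Fin k → Carrier) → Carrier
  splitSum {zero}  left right = 1#
  splitSum {suc k} left right = product right + left zero * splitSum (left ∘ suc) (right ∘ suc)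

  splitProduct : ∀ {k} → (Fin k → Carrier) → (Fin k → Carrier) → Fin (suc k) → Carrier
  splitProduct left right s = product (λ v → if toℕ v <ᵇ toℕ s then left v else right v)

  sum-splitProduct : ∀ {k} (left right : Fin k → Carrier) → sum (splitProduct left right) ≈ splitSum left right
  sum-splitProduct {zero}  left right = +-identityʳ 1#
  sum-splitProduct {suc k} left right =
    +-congˡ (≈-trans (≈-sym (*-distribˡ-sum (left zero) (splitProduct (left ∘ suc) (right ∘ suc))))
                     (*-congˡ (sum-splitProduct (left ∘ suc) (right ∘ suc))))

module PathForests {c ℓ} (R : CommutativeRing c ℓ) {m : ℕ}
  {w : Fin (suc (suc m)) → Fin (suc (suc m)) → Maybe (CommutativeRing.Carrier R)}
  {left right : Fin m → CommutativeRing.Carrier R}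
  (path : IsPathGraph w left right) where

  open CommutativeRing R hiding (zero)
    renaming (refl to ≈-refl; sym to ≈-sym; trans to ≈-trans; reflexive to ≈-reflexive)
  open Sums R
  open IsPathGraph path
  open import Relation.Binary.Reasoning.Setoid setoid

  private
    N : ℕ
    N = suc (suc m)

    rooted : Fin N → Bool
    rooted = isRoot R w zero (suc zero)

    weight : (Fin N → Fin N) → Carrier
    weight = forestWeight R w zero (suc zero)

    forest? : (Fin N → Fin N) → Bool
    forest? = isForest R w zero (suc zero)

    -- forest? f unfolds to all (ok f) (allFin N)
    ok : (Fin N → Fin N) → Fin N → Bool
    ok f v = if rooted v then f v == v else (is-just (w v (f v)) ∧ rooted (iter f N v))

  edge-out-of-inner : ∀ v t → is-just (w (inner v) t) ≡ true → t ≡ leftOf v ⊎ t ≡ rightOf v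
  edge-out-of-inner v t edge with t ≟ᶠ leftOf v | t ≟ᶠ rightOf v
  ... | yes t≡l | _       = inj₁ t≡l
  ... | no _    | yes t≡r = inj₂ t≡r
  ... | no t≢l  | no t≢r with trans (sym (cong is-just (no-other v t t≢l t≢r))) edge
  ...   | ()

  splitForest : Fin (suc m) → Fin N → Fin N
  splitForest s zero          = zero
  splitForest s (suc zero)    = suc zero
  splitForest s (suc (suc v)) = if toℕ v <ᵇ toℕ s then leftOf v else rightOf v

  splitForest-left : ∀ s v → toℕ v < toℕ s → splitForest s (inner v) ≡ leftOf v
  splitForest-left s v v<s rewrite <⇒<ᵇ≡true v<s = refl

  splitForest-right : ∀ s v → toℕ s ≤ toℕ v → splitForest s (inner v) ≡ rightOf v
  splitForest-right s v s≤v rewrite ≥⇒<ᵇ≡false s≤v = refl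

  splitForest-reaches-left : ∀ s k v → toℕ v ≡ k → toℕ v < toℕ s → iter (splitForest s) (suc k) (inner v) ≡ zero
  splitForest-reaches-left s zero    zero    _ v<s = splitForest-left s zero v<s
  splitForest-reaches-left s (suc k) (suc v) v≡k v<s =
    trans (cong (iter (splitForest s) (suc k)) (splitForest-left s (suc v) v<s))
          (splitForest-reaches-left s k (inject₁ v) (trans (toℕ-inject₁ v) (ℕₚ.suc-injective v≡k))
             (ℕₚ.<-trans (subst (_< suc (toℕ v)) (sym (toℕ-inject₁ v)) (ℕₚ.n<1+n _)) v<s))

  splitForest-reaches-right : ∀ s d v → suc (toℕ v) ℕ.+ d ≡ m → toℕ s ≤ toℕ v
                            → iter (splitForest s) (suc d) (inner v) ≡ suc zero
  splitForest-reaches-right s zero v v+1≡m s≤v =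
    trans (splitForest-right s v s≤v) (rightOf-last v (trans (sym (ℕₚ.+-identityʳ _)) v+1≡m))
  splitForest-reaches-right s (suc d) v v+1+d+1≡m s≤v =
    trans (cong (iter (splitForest s) (suc d)) (trans (splitForest-right s v s≤v) (rightOf-inner v v+1<m)))
          (splitForest-reaches-right s d (fromℕ< v+1<m)
             (trans (cong (λ z → suc z ℕ.+ d) (toℕ-fromℕ< v+1<m)) (trans (sym (ℕₚ.+-suc (suc (toℕ v)) d)) v+1+d+1≡m))
             (≤-trans s≤v (subst (toℕ v ≤_) (sym (toℕ-fromℕ< v+1<m)) (ℕₚ.n≤1+n _))))
    where
    v+1<m : suc (toℕ v) < m
    v+1<m = subst (suc (toℕ v) <_) v+1+d+1≡m
              (subst (suc (suc (toℕ v)) ≤_) (sym (ℕₚ.+-suc (suc (toℕ v)) d)) (s≤s (ℕₚ.m≤m+n (suc (toℕ v)) d)))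

  splitForest-isForest : ∀ s → forest? (splitForest s) ≡ true
  splitForest-isForest s = all-allFin⁺ (ok (splitForest s)) ok-at
    where
    ok-at : ∀ v → ok (splitForest s) v ≡ true
    ok-at zero       = refl
    ok-at (suc zero) = ==-refl {N} (suc zero)
    ok-at (suc (suc v)) with toℕ v ℕ.<? toℕ s
    ... | yes v<s = cong₂ _∧_ (cong is-just (trans (cong (w (inner v)) (splitForest-left s v v<s)) (to-left v)))
                      (cong rooted (iter-fixed (splitForest s) (suc (toℕ v)) refl
                                      (s≤s (≤-trans (ℕₚ.<⇒≤ (toℕ<n v)) (ℕₚ.n≤1+n m)))
                                      (splitForest-reaches-left s (toℕ v) v refl v<s)))
    ... | no v≮s = cong₂ _∧_ (cong is-just (trans (cong (w (inner v)) (splitForest-right s v (ℕₚ.≮⇒≥ v≮s))) (to-right v)))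
                      (cong rooted (iter-fixed (splitForest s) (suc (m ∸ suc (toℕ v))) refl
                                      (s≤s (≤-trans (ℕₚ.m∸n≤m m (suc (toℕ v))) (ℕₚ.n≤1+n m)))
                                      (splitForest-reaches-right s (m ∸ suc (toℕ v)) v (ℕₚ.m+[n∸m]≡n (toℕ<n v))
                                         (ℕₚ.≮⇒≥ v≮s))))

  -- Two neighbours pointing at each other would never reach a root, so the set of
  -- vertices moving right is upward closed.
  isForest⇒splitForest : ∀ f → forest? f ≡ true → Σ (Fin (suc m)) (λ s → f ≗ splitForest s)
  isForest⇒splitForest f is-forest = s , f≗
    where
    ok-at : ∀ v → ok f v ≡ true
    ok-at = all-allFin⁻ (ok f) is-forest
    moves : ∀ v → f (inner v) ≡ leftOf v ⊎ f (inner v) ≡ rightOf v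
    moves v = edge-out-of-inner v (f (inner v)) (proj₁ (∧≡true⇒ (ok-at (inner v))))
    reaches-root : ∀ v → rooted (iter f N (inner v)) ≡ true
    reaches-root v = proj₂ (∧≡true⇒ (ok-at (inner v)))
    moves-right : Fin m → Bool
    moves-right v = f (inner v) == rightOf v
    moves-left : ∀ v → moves-right v ≡ false → f (inner v) ≡ leftOf v
    moves-left v not-right with moves v
    ... | inj₁ l = l
    ... | inj₂ r with trans (sym not-right) (≡⇒== r)
    ...   | ()
    trapped : ∀ v v′ → iter f N (inner v) ≡ inner v ⊎ iter f N (inner v) ≡ inner v′ → ⊥
    trapped v v′ (inj₁ e) with trans (sym (cong rooted e)) (reaches-root v)
    ... | ()
    trapped v v′ (inj₂ e) with trans (sym (cong rooted e)) (reaches-root v)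
    ... | ()
    upward-closed : ∀ v v′ → toℕ v′ ≡ suc (toℕ v) → moves-right v ≡ true → moves-right v′ ≡ true
    upward-closed v v′ v′≡v+1 v-right with moves-right v′ in v′-right
    ... | true  = refl
    ... | false = ⊥-elim (trapped v v′ (iter-2-cycle f[v]≡v′ f[v′]≡v N))
      where
      f[v]≡v′ : f (inner v) ≡ inner v′
      f[v]≡v′ = trans (==⇒≡ v-right) (position-injective (trans (position-rightOf v) (cong suc (sym v′≡v+1))))
      f[v′]≡v : f (inner v′) ≡ inner v
      f[v′]≡v = trans (moves-left v′ v′-right) (position-injective (trans (position-leftOf v′) v′≡v+1))
    s : Fin (suc m)
    s = proj₁ (threshold moves-right upward-closed)
    moves-right≡ : ∀ v → moves-right v ≡ not (toℕ v <ᵇ toℕ s)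
    moves-right≡ = proj₂ (threshold moves-right upward-closed)
    f≗ : f ≗ splitForest s
    f≗ zero       = ==⇒≡ (ok-at zero)
    f≗ (suc zero) = ==⇒≡ (ok-at (suc zero))
    f≗ (suc (suc v)) with toℕ v ℕ.<? toℕ s
    ... | yes v<s = trans (moves-left v (trans (moves-right≡ v) (cong not (<⇒<ᵇ≡true v<s))))
                          (sym (splitForest-left s v v<s))
    ... | no v≮s  = trans (==⇒≡ (trans (moves-right≡ v) (cong not (≥⇒<ᵇ≡false (ℕₚ.≮⇒≥ v≮s)))))
                          (sym (splitForest-right s v (ℕₚ.≮⇒≥ v≮s)))

  splitForest-distinct : ∀ a b → toℕ a < toℕ b → splitForest a ≗ splitForest b → ⊥
  splitForest-distinct a b a<b same =
    leftOf≢rightOf v (trans (sym (splitForest-left b v v<b))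
                            (trans (sym (same (inner v))) (splitForest-right a v (ℕₚ.≤-reflexive (sym v≡a)))))
    where
    a<m : toℕ a < m
    a<m = ℕₚ.<-≤-trans a<b (toℕ≤pred[n] b)
    v : Fin m
    v = fromℕ< a<m
    v≡a : toℕ v ≡ toℕ a
    v≡a = toℕ-fromℕ< a<m
    v<b : toℕ v < toℕ b
    v<b = subst (_< toℕ b) (sym v≡a) a<b

  splitForest-injective : ∀ s s′ → splitForest s ≗ splitForest s′ → s ≡ s′
  splitForest-injective s s′ same with ℕₚ.<-cmp (toℕ s) (toℕ s′)
  ... | tri≈ _ s≡s′ _ = toℕ-injective s≡s′
  ... | tri< s<s′ _ _ = ⊥-elim (splitForest-distinct s s′ s<s′ same)
  ... | tri> _ _ s′<s = ⊥-elim (splitForest-distinct s′ s s′<s (sym ∘ same))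

  isForest-resp-≗ : ∀ {f g} → f ≗ g → forest? g ≡ true → forest? f ≡ true
  isForest-resp-≗ {f} {g} f≗g g-forest = all-allFin⁺ (ok f) (λ v → trans (same-test v) (all-allFin⁻ (ok g) g-forest v))
    where
    same-test : ∀ v → ok f v ≡ ok g v
    same-test v = cong₂ (λ x y → if rooted v then x == v else (is-just (w v x) ∧ rooted y)) (f≗g v) (iter-cong f≗g N v)

  weight-resp-≗ : ∀ {f g} → f ≗ g → weight f ≡ weight g
  weight-resp-≗ f≗g = cong (prodL R) (map-cong (λ v → cong (λ x → if rooted v then 1# else fromMaybe 0# (w v x)) (f≗g v)) (allFin N))

  weight-splitForest : ∀ s → weight (splitForest s) ≈ splitProduct left right s
  weight-splitForest s = begin
      weight (splitForest s)
    ≡⟨ product-map-allFin {N} _ ⟩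
      1# * (1# * product (λ v → fromMaybe 0# (w (inner v) (splitForest s (inner v)))))
    ≈⟨ ≈-trans (*-identityˡ _) (*-identityˡ _) ⟩
      product (λ v → fromMaybe 0# (w (inner v) (splitForest s (inner v))))
    ≡⟨ product-cong-≗ edge-weight ⟩
      splitProduct left right s ∎
    where
    edge-weight : ∀ v → fromMaybe 0# (w (inner v) (splitForest s (inner v)))
                      ≡ (if toℕ v <ᵇ toℕ s then left v else right v)
    edge-weight v with toℕ v <ᵇ toℕ s
    ... | true  rewrite to-left v  = refl
    ... | false rewrite to-right v = refl

  forestIndicator≈sum : ∀ f → (if forest? f then weight f else 0#)
                            ≈ sum (λ s → if sameFun f (splitForest s) then weight (splitForest s) else 0#)
  forestIndicator≈sum f with forest? f in f-forest
  ... | true = ≈-trans (≈-sym (sum-δ s₀ (weight f))) (sum-cong-≋ {suc m} term)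
    where
    s₀ : Fin (suc m)
    s₀ = proj₁ (isForest⇒splitForest f f-forest)
    f≗ : f ≗ splitForest s₀
    f≗ = proj₂ (isForest⇒splitForest f f-forest)
    term : ∀ s → (if s == s₀ then weight f else 0#)
               ≈ (if sameFun f (splitForest s) then weight (splitForest s) else 0#)
    term s with s ≟ᶠ s₀
    ... | yes refl rewrite ≗⇒sameFun f≗ = ≈-reflexive (weight-resp-≗ f≗)
    ... | no s≢s₀ with sameFun f (splitForest s) in same
    ...   | true  = ⊥-elim (s≢s₀ (splitForest-injective s s₀ (λ x → trans (sym (sameFun⇒≗ {f = f} {splitForest s} same x)) (f≗ x))))
    ...   | false = ≈-refl
  ... | false = ≈-sym (sum-zero {suc m} _ term)
    where
    term : ∀ s → (if sameFun f (splitForest s) then weight (splitForest s) else 0#) ≈ 0#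
    term s with sameFun f (splitForest s) in same
    ... | false = ≈-refl
    ... | true with trans (sym f-forest) (isForest-resp-≗ (sameFun⇒≗ {f = f} {splitForest s} same) (splitForest-isForest s))
    ...   | ()

  forestGF≈splitSum : forestGF R w zero (suc zero) ≈ splitSum left right
  forestGF≈splitSum = begin
      sumOver (λ f → if forest? f then weight f else 0#) (allFuns N N)
    ≈⟨ sumOver-cong forestIndicator≈sum (allFuns N N) ⟩
      sumOver (λ f → sum (λ s → δ s f)) (allFuns N N)
    ≈⟨ sumOver-sum (λ f s → δ s f) (allFuns N N) ⟩
      sum (λ s → sumOver (δ s) (allFuns N N))
    ≈⟨ sum-cong-≋ (λ s → sumOver-allFuns-δ N N (splitForest s) (weight (splitForest s))) ⟩
      sum (λ s → weight (splitForest s))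
    ≈⟨ sum-cong-≋ weight-splitForest ⟩
      sum (splitProduct left right)
    ≈⟨ sum-splitProduct left right ⟩
      splitSum left right ∎
    where
    δ : Fin (suc m) → (Fin N → Fin N) → Carrier
    δ s f = if sameFun f (splitForest s) then weight (splitForest s) else 0#

-- Tridiagonal determinants

module Tridiagonal {c ℓ} (R : CommutativeRing c ℓ) where

  open CommutativeRing R hiding (zero)
    renaming (refl to ≈-refl; sym to ≈-sym; trans to ≈-trans; reflexive to ≈-reflexive)
  open Sums R
  open import Relation.Binary.Reasoning.Setoid setoid
  open import Algebra.Solver.Ring.NaturalCoefficients.Default commutativeSemiring
  open import Algebra.Properties.Ring ring using (-‿distribˡ-*; -‿distribʳ-*; -1*x≈-x)
  open import Algebra.Properties.Group +-group using (⁻¹-involutive; ε⁻¹≈ε)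

  sign : ∀ {k} → Fin k → Carrier
  sign j = if even (toℕ j) then 1# else - 1#

  minor : ∀ {k} → (Fin (suc k) → Fin (suc k) → Carrier) → Fin (suc k) → Fin k → Fin k → Carrier
  minor M j a b = M (suc a) (punchIn j b)

  laplaceTerm : ∀ {k} → (Fin (suc k) → Fin (suc k) → Carrier) → Fin (suc k) → Carrier
  laplaceTerm M j = sign j * (M zero j * det R (minor M j))

  det-expand : ∀ {k} (M : Fin (suc k) → Fin (suc k) → Carrier) → det R M ≈ sum (laplaceTerm M)
  det-expand M = ≈-reflexive (sum-map-allFin (laplaceTerm M))

  private
    *0 : ∀ {x y} → y ≈ 0# → x * y ≈ 0#
    *0 {x} y≈0 = ≈-trans (*-congˡ y≈0) (zeroʳ x)

    0* : ∀ {x y} → x ≈ 0# → x * y ≈ 0#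
    0* {y = y} x≈0 = ≈-trans (*-congʳ x≈0) (zeroˡ y)

  det-column-zero : ∀ k (M : Fin (suc k) → Fin (suc k) → Carrier) → (∀ i → M i zero ≈ 0#) → det R M ≈ 0#
  det-column-zero k M col≈0 = ≈-trans (det-expand M) (sum-zero (laplaceTerm M) (term≈0 k M col≈0))
    where
    term≈0 : ∀ k (M : Fin (suc k) → Fin (suc k) → Carrier) → (∀ i → M i zero ≈ 0#) → ∀ j → laplaceTerm M j ≈ 0#
    term≈0 k       M col≈0 zero    = *0 (0* (col≈0 zero))
    term≈0 (suc k) M col≈0 (suc j) = *0 (*0 (det-column-zero k (minor M (suc j)) (col≈0 ∘ suc)))

  det-column-pivot : ∀ k (M : Fin (suc k) → Fin (suc k) → Carrier) → (∀ i → M (suc i) zero ≈ 0#)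
                   → det R M ≈ M zero zero * det R (minor M zero)
  det-column-pivot k M col≈0 = begin
      det R M
    ≈⟨ det-expand M ⟩
      1# * (M zero zero * det R (minor M zero)) + sum (laplaceTerm M ∘ suc)
    ≈⟨ +-cong (*-identityˡ _) (sum-zero _ (term≈0 k M col≈0)) ⟩
      M zero zero * det R (minor M zero) + 0#
    ≈⟨ +-identityʳ _ ⟩
      M zero zero * det R (minor M zero) ∎
    where
    term≈0 : ∀ k (M : Fin (suc k) → Fin (suc k) → Carrier) → (∀ i → M (suc i) zero ≈ 0#) → ∀ j → laplaceTerm M (suc j) ≈ 0#
    term≈0 (suc k) M col≈0 j = *0 (*0 (det-column-zero k (minor M (suc j)) col≈0))

  record IsTridiagonal {k} (M : Fin k → Fin k → Carrier) (left right : Fin k → Carrier) : Set (c ⊔ ℓ) where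
    field
      diagonal  : ∀ i → M i i ≈ right i + left i
      above     : ∀ i j → toℕ j ≡ suc (toℕ i) → M i j ≈ - right i
      below     : ∀ i j → toℕ i ≡ suc (toℕ j) → M i j ≈ - left i
      far-above : ∀ i j → suc (suc (toℕ i)) ≤ toℕ j → M i j ≈ 0#
      far-below : ∀ i j → suc (suc (toℕ j)) ≤ toℕ i → M i j ≈ 0#

  tail : ∀ {k} {M : Fin (suc k) → Fin (suc k) → Carrier} {left right}
       → IsTridiagonal M left right → IsTridiagonal (minor M zero) (left ∘ suc) (right ∘ suc)
  tail t = record
    { diagonal  = λ i → diagonal (suc i)
    ; above     = λ i j e → above (suc i) (suc j) (cong suc e)
    ; below     = λ i j e → below (suc i) (suc j) (cong suc e)
    ; far-above = λ i j h → far-above (suc i) (suc j) (s≤s h)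
    ; far-below = λ i j h → far-below (suc i) (suc j) (s≤s h)
    }
    where open IsTridiagonal t

  -- The first two terms of the Laplace expansion, once the minors are evaluated.
  two-term-expansion : ∀ r₀ l₀ l₁ P S → (r₀ + l₀) * (P + l₁ * S) + ((- 1#) * ((- r₀) * ((- l₁) * S)) + 0#)
                                      ≈ r₀ * P + l₀ * (P + l₁ * S)
  two-term-expansion r₀ l₀ l₁ P S = begin
      (r₀ + l₀) * (P + l₁ * S) + ((- 1#) * ((- r₀) * ((- l₁) * S)) + 0#)
    ≈⟨ +-cong expand (≈-trans (+-identityʳ _) signs) ⟩
      (T + Z) + - Z
    ≈⟨ +-assoc T Z (- Z) ⟩
      T + (Z + - Z)
    ≈⟨ +-congˡ (-‿inverseʳ Z) ⟩
      T + 0#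
    ≈⟨ +-identityʳ T ⟩
      T ∎
    where
    T = r₀ * P + l₀ * (P + l₁ * S)
    Z = r₀ * (l₁ * S)
    expand : (r₀ + l₀) * (P + l₁ * S) ≈ T + Z
    expand = solve 5 (λ r₀ l₀ l₁ P S → (r₀ :+ l₀) :* (P :+ l₁ :* S) := (r₀ :* P :+ l₀ :* (P :+ l₁ :* S)) :+ r₀ :* (l₁ :* S))
                   ≈-refl r₀ l₀ l₁ P S
    signs : (- 1#) * ((- r₀) * ((- l₁) * S)) ≈ - Z
    signs = begin
        (- 1#) * ((- r₀) * ((- l₁) * S))
      ≈⟨ -1*x≈-x _ ⟩
        - ((- r₀) * ((- l₁) * S))
      ≈⟨ -‿cong (*-congˡ (≈-sym (-‿distribˡ-* l₁ S))) ⟩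
        - ((- r₀) * (- (l₁ * S)))
      ≈⟨ -‿cong (≈-sym (-‿distribˡ-* r₀ (- (l₁ * S)))) ⟩
        - (- (r₀ * (- (l₁ * S))))
      ≈⟨ ⁻¹-involutive _ ⟩
        r₀ * (- (l₁ * S))
      ≈⟨ ≈-sym (-‿distribʳ-* r₀ (l₁ * S)) ⟩
        - Z ∎

  det-tridiagonal-step : ∀ k (M : Fin (suc (suc k)) → Fin (suc (suc k)) → Carrier) left right
    → IsTridiagonal M left right
    → det R (minor M zero) ≈ splitSum (left ∘ suc) (right ∘ suc)
    → det R (minor (minor M zero) zero) ≈ splitSum (λ i → left (suc (suc i))) (λ i → right (suc (suc i)))
    → det R M ≈ splitSum left right
  det-tridiagonal-step k M left right t det₁ det₂ = begin
      det R M
    ≈⟨ det-expand M ⟩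
      laplaceTerm M zero + (laplaceTerm M (suc zero) + sum {k} (λ j → laplaceTerm M (suc (suc j))))
    ≈⟨ +-cong first (+-cong second (sum-zero {k} _ rest)) ⟩
      1# * ((right zero + left zero) * splitSum (left ∘ suc) (right ∘ suc))
        + ((- 1#) * ((- right zero) * ((- left (suc zero)) * S₂)) + 0#)
    ≈⟨ +-congʳ (*-identityˡ _) ⟩
      (right zero + left zero) * splitSum (left ∘ suc) (right ∘ suc)
        + ((- 1#) * ((- right zero) * ((- left (suc zero)) * S₂)) + 0#)
    ≈⟨ two-term-expansion (right zero) (left zero) (left (suc zero)) (product {suc k} (right ∘ suc)) S₂ ⟩
      splitSum left right ∎
    where
    open IsTridiagonal t
    S₂ : Carrier
    S₂ = splitSum {k} (λ i → left (suc (suc i))) (λ i → right (suc (suc i)))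
    first : laplaceTerm M zero ≈ 1# * ((right zero + left zero) * splitSum (left ∘ suc) (right ∘ suc))
    first = *-congˡ (*-cong (diagonal zero) det₁)
    second : laplaceTerm M (suc zero) ≈ (- 1#) * ((- right zero) * ((- left (suc zero)) * S₂))
    second = *-congˡ (*-cong (above zero (suc zero) refl)
               (≈-trans (det-column-pivot k (minor M (suc zero)) (λ i → far-below (suc (suc i)) zero (s≤s (s≤s z≤n))))
                        (*-cong (below (suc zero) zero refl) det₂)))
    rest : ∀ j → laplaceTerm M (suc (suc j)) ≈ 0#
    rest j = *0 (0* (far-above zero (suc (suc j)) (s≤s (s≤s z≤n))))

  det-tridiagonal : ∀ k (M : Fin k → Fin k → Carrier) left right → IsTridiagonal M left right
                  → det R M ≈ splitSum left right
  det-tridiagonal zero          M left right t = ≈-refl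
  det-tridiagonal (suc zero)    M left right t = begin
      det R M
    ≈⟨ det-expand M ⟩
      1# * (M zero zero * 1#) + 0#
    ≈⟨ ≈-trans (+-identityʳ _) (≈-trans (*-identityˡ _) (*-identityʳ _)) ⟩
      M zero zero
    ≈⟨ IsTridiagonal.diagonal t zero ⟩
      right zero + left zero
    ≈⟨ ≈-sym (+-cong (*-identityʳ _) (*-identityʳ _)) ⟩
      right zero * 1# + left zero * 1# ∎
  det-tridiagonal (suc (suc k)) M left right t =
    det-tridiagonal-step k M left right t
      (det-tridiagonal (suc k) _ _ _ (tail t))
      (det-tridiagonal k _ _ _ (tail (tail t)))

  module _ {m : ℕ} (q : Fin (suc m) → Fin (suc m) → Carrier) where

    Qmat-diagonal : ∀ i → Qmat R q i i ≡ - (q i (next i) + q i (prev i))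
    Qmat-diagonal i rewrite ==-refl i = refl

    Qmat-adjacent : ∀ i j → i ≢ j → j ≡ next i ⊎ j ≡ prev i → Qmat R q i j ≡ q i j
    Qmat-adjacent i j i≢j (inj₁ refl) rewrite ≢⇒== i≢j | ==-refl (next i) = refl
    Qmat-adjacent i j i≢j (inj₂ refl) rewrite ≢⇒== i≢j | ==-refl (prev i) | ∨-zeroʳ (prev i == next i) = refl

    Qmat-far : ∀ i j → i ≢ j → j ≢ next i → j ≢ prev i → Qmat R q i j ≡ 0#
    Qmat-far i j i≢j j≢next j≢prev rewrite ≢⇒== i≢j | ≢⇒== j≢next | ≢⇒== j≢prev = refl

    private
      next-suc : ∀ (i : Fin m) → toℕ (next {suc m} (suc i)) ≡ suc (suc (toℕ i)) ⊎ next {suc m} (suc i) ≡ zero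
      next-suc i with suc (toℕ i) ℕ.≟ m
      ... | yes i+1≡m = inj₂ (next-last (suc i) i+1≡m)
      ... | no i+1≢m  = inj₁ (toℕ-next (suc i) (ℕₚ.≤∧≢⇒< (toℕ<n i) i+1≢m))

    negQ-tridiagonal : IsTridiagonal (λ a b → - Qmat R q (suc a) (suc b)) (leftRate q) (rightRate q)
    negQ-tridiagonal = record
      { diagonal  = λ i → ≈-trans (-‿cong (≈-reflexive (Qmat-diagonal (suc i)))) (⁻¹-involutive _)
      ; above     = above
      ; below     = below
      ; far-above = far-above
      ; far-below = far-below
      }
      where
      above : ∀ i j → toℕ j ≡ suc (toℕ i) → - Qmat R q (suc i) (suc j) ≈ - rightRate q i
      above i j j≡i+1 = -‿cong (≈-reflexive (trans (Qmat-adjacent (suc i) (suc j) i≢j (inj₁ j≡next)) (cong (q (suc i)) j≡next)))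
        where
        i≢j : suc {m} i ≢ suc j
        i≢j = <⇒≢ (s≤s (ℕₚ.≤-reflexive (sym j≡i+1)))
        j≡next : suc j ≡ next (suc i)
        j≡next = toℕ-injective (trans (cong suc j≡i+1)
                   (sym (toℕ-next (suc i) (subst (_< m) j≡i+1 (toℕ<n j)))))
      below : ∀ i j → toℕ i ≡ suc (toℕ j) → - Qmat R q (suc i) (suc j) ≈ - leftRate q i
      below i j i≡j+1 = -‿cong (≈-reflexive (trans (Qmat-adjacent (suc i) (suc j) i≢j (inj₂ j≡prev)) (cong (q (suc i)) j≡prev)))
        where
        i≢j : suc {m} i ≢ suc j
        i≢j e = <⇒≢ (s≤s (ℕₚ.≤-reflexive (sym i≡j+1))) (sym e)
        j≡prev : suc j ≡ prev (suc i)
        j≡prev = toℕ-injective (trans (sym i≡j+1) (sym (toℕ-inject₁ i)))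
      far : ∀ i j → suc i ≢ suc j → suc j ≢ next (suc i) → suc j ≢ prev (suc i) → - Qmat R q (suc i) (suc j) ≈ 0#
      far i j i≢j j≢next j≢prev = ≈-trans (-‿cong (≈-reflexive (Qmat-far (suc i) (suc j) i≢j j≢next j≢prev))) ε⁻¹≈ε
      far-above : ∀ i j → suc (suc (toℕ i)) ≤ toℕ j → - Qmat R q (suc i) (suc j) ≈ 0#
      far-above i j i+2≤j = far i j (<⇒≢ (s≤s (ℕₚ.<⇒≤ i+2≤j))) j≢next
                              (λ e → <-irrefl (sym (trans (cong toℕ e) (toℕ-inject₁ i)))
                                       (ℕₚ.<-trans (ℕₚ.<-trans (ℕₚ.n<1+n _) i+2≤j) (ℕₚ.n<1+n _)))
        where
        j≢next : suc j ≢ next (suc i)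
        j≢next e with next-suc i
        ... | inj₁ next≡i+2 = <-irrefl (sym (ℕₚ.suc-injective (trans (cong toℕ e) next≡i+2))) i+2≤j
        ... | inj₂ next≡0 with trans e next≡0
        ...   | ()
      far-below : ∀ i j → suc (suc (toℕ j)) ≤ toℕ i → - Qmat R q (suc i) (suc j) ≈ 0#
      far-below i j j+2≤i = far i j (λ e → <⇒≢ (s≤s (ℕₚ.<⇒≤ j+2≤i)) (sym e)) j≢next
                              (λ e → <-irrefl (trans (cong toℕ e) (toℕ-inject₁ i)) j+2≤i)
        where
        j≢next : suc j ≢ next (suc i)
        j≢next e with next-suc i
        ... | inj₁ next≡i+2 = <-irrefl (trans (cong toℕ e) next≡i+2)
                                (s≤s (s≤s (≤-trans (ℕₚ.n≤1+n _) (≤-trans (ℕₚ.n≤1+n _) j+2≤i))))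
        ... | inj₂ next≡0 with trans e next≡0
        ...   | ()

-- G and H

module BracketPaths {m : ℕ} (m≥2 : 2 ≤ m) (τ : Fin (suc m) → Fin (suc m) → Fin (suc m) → Fin (suc m))
                    (brackets : ∀ i j → IsBracket (rtree i (τ i j)) i j) where

  open Brackets {m} (ℕₚ.<⇒≤ m≥2) using ([k,n]-shape; [1,1]-shape; [k,1]-shape)

  vertices : Fin (suc m) → Vec (RTree (suc m)) (suc (suc m))
  vertices j = rtree zero (τ zero (fromℕ m)) ∷ᵥ rtree zero (τ zero zero) ∷ᵥ tabulateᵥ (λ v → rtree (suc v) (τ (suc v) j))

  lookup-inner : ∀ j v → lookup (vertices j) (inner v) ≡ rtree (suc v) (τ (suc v) j)
  lookup-inner j v = lookup∘tabulate (λ v → rtree (suc v) (τ (suc v) j)) v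

  root-vertices : ∀ j u → root (lookup (vertices j) u) ≡ rootAt u
  root-vertices j zero          = refl
  root-vertices j (suc zero)    = refl
  root-vertices j (suc (suc v)) = cong root (lookup-inner j v)

  fixed-vertices : ∀ j u → parent (lookup (vertices j) u) (rootAt u) ≡ rootAt u
  fixed-vertices j zero          = proj₁ (proj₁ (proj₂ (brackets zero (fromℕ m))))
  fixed-vertices j (suc zero)    = proj₁ (proj₁ (proj₂ (brackets zero zero)))
  fixed-vertices j (suc (suc v)) rewrite lookup-inner j v = proj₁ (proj₁ (proj₂ (brackets (suc v) j)))

  [1,1]-forward : ∀ {D : ℕ → ℕ → Bool} → (∀ x → x ≢ zero → D (suc m) (toℕ {suc m} x) ≡ true)
                → ∀ x → x ≢ zero → τ zero zero x ≡ step (D (suc m) (toℕ x)) x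
  [1,1]-forward D-true x x≢0 rewrite D-true x x≢0 = [1,1]-shape (τ zero zero) (brackets zero zero) x x≢0

  G-isPathGraph : ∀ {c ℓ} (R : CommutativeRing c ℓ) q → IsPathGraph (induced R q (vertices zero)) (leftRate q) (rightRate q)
  G-isPathGraph R q = Lifting.induced-isPathGraph m≥2 forward-[k,1]
    forward-[k,1]-elsewhere forward-[k,1]-at-root forward-[k,1]-above
    (cong (_∧ true) (<⇒<ᵇ≡true (s≤s m≥2))) (cong (_∧ true) (<⇒<ᵇ≡true m≥2))
    (vertices zero) (root-vertices zero) (fixed-vertices zero) shape R q
    where
    shape : ∀ u x → x ≢ rootAt u → parent (lookup (vertices zero) u) x ≡ step (forward-[k,1] (position u) (toℕ x)) x
    shape zero          = [k,n]-shape zero (τ zero (fromℕ m)) (brackets zero (fromℕ m))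
    shape (suc zero)    = [1,1]-forward {forward-[k,1]} inside
      where
      inside : ∀ x → x ≢ zero → forward-[k,1] (suc m) (toℕ {suc m} x) ≡ true
      inside zero    x≢0 = ⊥-elim (x≢0 refl)
      inside (suc x) _   rewrite <⇒<ᵇ≡true (toℕ<n (suc x)) = refl
    shape (suc (suc v)) rewrite lookup-inner zero v = [k,1]-shape v (τ (suc v) zero) (brackets (suc v) zero)

  H-isPathGraph : ∀ {c ℓ} (R : CommutativeRing c ℓ) q → IsPathGraph (induced R q (vertices (fromℕ m))) (leftRate q) (rightRate q)
  H-isPathGraph R q = Lifting.induced-isPathGraph m≥2 forward-[k,n]
    forward-[k,n]-elsewhere (λ K _ → forward-[k,n]-at-root K) forward-[k,n]-above
    (<⇒<ᵇ≡true (s≤s m≥2)) (<⇒<ᵇ≡true m≥2)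
    (vertices (fromℕ m)) (root-vertices (fromℕ m)) (fixed-vertices (fromℕ m)) shape R q
    where
    shape : ∀ u x → x ≢ rootAt u → parent (lookup (vertices (fromℕ m)) u) x ≡ step (forward-[k,n] (position u) (toℕ x)) x
    shape zero          = [k,n]-shape zero (τ zero (fromℕ m)) (brackets zero (fromℕ m))
    shape (suc zero)    = [1,1]-forward {forward-[k,n]} (λ x _ → <⇒<ᵇ≡true (toℕ<n x))
    shape (suc (suc v)) rewrite lookup-inner (fromℕ m) v = [k,n]-shape (suc v) (τ (suc v) (fromℕ m)) (brackets (suc v) (fromℕ m))

lemma2 : ∀ {c ℓ} (R : CommutativeRing c ℓ) (n : ℕ) (n≥3 : 3 ≤ n)
           (q : Fin n → Fin n → CommutativeRing.Carrier R)
           (τ : Fin n → Fin n → Fin n → Fin n)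
           → (∀ i j → IsBracket (rtree i (τ i j)) i j)
           → CommutativeRing._≈_ R
               (forestGF R (induced R q (Gverts {n} n≥3 τ)) (pos[1,n] n≥3) (pos[1,1] n≥3))
               (det R (negQ1 R n≥3 q))
             × CommutativeRing._≈_ R
               (forestGF R (induced R q (Hverts {n} n≥3 τ)) (pos[1,n] n≥3) (pos[1,1] n≥3))
               (det R (negQ1 R n≥3 q))
lemma2 R (suc m) (s≤s m≥2) q τ brackets =
  forestGF≈det (G-isPathGraph R q) , forestGF≈det (H-isPathGraph R q)
  where
  open CommutativeRing R using (_≈_) renaming (trans to ≈-trans; sym to ≈-sym)
  open BracketPaths m≥2 τ brackets
  open Tridiagonal R using (det-tridiagonal; negQ-tridiagonal)
  forestGF≈det : ∀ {w} → IsPathGraph w (leftRate q) (rightRate q) → forestGF R w zero (suc zero) ≈ det R (negQ1 R (s≤s m≥2) q)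
  forestGF≈det path = ≈-trans (PathForests.forestGF≈splitSum R path) (≈-sym (det-tridiagonal m _ _ _ (negQ-tridiagonal q)))
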